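{- For every integer $k\ge 5$, the path $P_k$ defines the graph $F_1$; that is, there is a coalition partition $\Psi$ of $P_k$ with $\mathrm{CG}(P_k,\Psi)\cong F_1$, where $F_1$ is the graph obtained from a triangle by attaching one pendant edge.
   Context: For a graph $G$ with vertex set $V$, a set $S\subseteq V$ is a dominating set if every vertex of $V\setminus S$ is adjacent to a vertex of $S$. Two disjoint sets $V_1,V_2\subseteq V$ form a coalition in $G$ if neither is a dominating set of $G$ but $V_1\cup V_2$ is. A coalition partition of $G$ is a partition $\Psi=\{V_1,\ldots,V_k\}$ of $V$ such that every $V_i\in\Psi$ is either a dominating set of $G$ with $|V_i|=1$, or is not a dominating set and forms a coalition with some $V_j\in\Psi$. Given a coalition partition $\Psi$ of $G$, the coalition graph $\mathrm{CG}(G,\Psi)$ has vertex set $\Psi$, two members adjacent iff they form a coalition in $G$. $P_k$ is the path on $k$ vertices. -}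

module Defs where

open import Data.Nat using (ℕ; suc; _≥_)
open import Data.Fin using (Fin; toℕ)
open import Data.Product using (Σ; ∃; _×_; _,_)
open import Data.Sum using (_⊎_)
open import Data.Empty using (⊥)
open import Relation.Nullary using (¬_)
open import Relation.Binary.PropositionalEquality using (_≡_; _≢_; sym)
open import Data.Sum using (inj₁; inj₂)
open import Data.Nat.Properties using (1+n≢n)
open import Function.Bundles using (_⤖_; Bijection)

record Graph (n : ℕ) : Set₁ where
  field
    Adj       : Fin n → Fin n → Set
    irrefl    : ∀ i → ¬ Adj i i
    symmetric : ∀ i j → Adj i j → Adj j i
open Graph public

VSet : ℕ → Set₁
VSet n = Fin n → Set

Dominating : ∀ {n} → Graph n → VSet n → Set
Dominating {n} G S = ∀ (v : Fin n) → ¬ S v → ∃ λ u → S u × Adj G u v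

_∪_ : ∀ {n} → VSet n → VSet n → VSet n
(A ∪ B) v = A v ⊎ B v

Disjoint : ∀ {n} → VSet n → VSet n → Set
Disjoint A B = ∀ v → A v → B v → ⊥

Coalition : ∀ {n} → Graph n → VSet n → VSet n → Set
Coalition G A B =
  Disjoint A B × ¬ Dominating G A × ¬ Dominating G B × Dominating G (A ∪ B)

record Partition (n m : ℕ) : Set where
  field
    cls      : Fin n → Fin m
    nonempty : ∀ (i : Fin m) → ∃ λ v → cls v ≡ i
open Partition public

Class : ∀ {n m} → Partition n m → Fin m → VSet n
Class P i v = cls P v ≡ i

Singleton : ∀ {n} → VSet n → Set
Singleton {n} S = ∃ λ (u : Fin n) → S u × (∀ v → S v → v ≡ u)

IsCoalitionPartition : ∀ {n m} → Graph n → Partition n m → Set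
IsCoalitionPartition {m = m} G P =
  ∀ (i : Fin m) →
    (Dominating G (Class P i) × Singleton (Class P i))
    ⊎ (¬ Dominating G (Class P i) × ∃ λ (j : Fin m) → Coalition G (Class P i) (Class P j))

CGAdj : ∀ {n m} → Graph n → Partition n m → Fin m → Fin m → Set
CGAdj G P i j = Coalition G (Class P i) (Class P j)

PathAdj : ∀ {k} → Fin k → Fin k → Set
PathAdj i j = suc (toℕ i) ≡ toℕ j ⊎ suc (toℕ j) ≡ toℕ i

PathGraph : (k : ℕ) → Graph k
PathGraph k = record { Adj = PathAdj ; irrefl = irr ; symmetric = sy }
  where
  irr : ∀ i → ¬ PathAdj i i
  irr i (inj₁ e) = 1+n≢n e
  irr i (inj₂ e) = 1+n≢n e
  sy : ∀ i j → PathAdj i j → PathAdj j i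
  sy i j (inj₁ e) = inj₂ e
  sy i j (inj₂ e) = inj₁ e

data F1Adj : Fin 4 → Fin 4 → Set where
  e01 : F1Adj (Fin.zero) (Fin.suc Fin.zero)
  e10 : F1Adj (Fin.suc Fin.zero) (Fin.zero)
  e02 : F1Adj (Fin.zero) (Fin.suc (Fin.suc Fin.zero))
  e20 : F1Adj (Fin.suc (Fin.suc Fin.zero)) (Fin.zero)
  e12 : F1Adj (Fin.suc Fin.zero) (Fin.suc (Fin.suc Fin.zero))
  e21 : F1Adj (Fin.suc (Fin.suc Fin.zero)) (Fin.suc Fin.zero)
  e23 : F1Adj (Fin.suc (Fin.suc Fin.zero)) (Fin.suc (Fin.suc (Fin.suc Fin.zero)))
  e32 : F1Adj (Fin.suc (Fin.suc (Fin.suc Fin.zero))) (Fin.suc (Fin.suc Fin.zero))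

Iso : ∀ {m p} → (Fin m → Fin m → Set) → (Fin p → Fin p → Set) → Set
Iso {m} {p} R S = Σ (Fin m ⤖ Fin p) λ f →
  ∀ i j → (R i j → S (Bijection.to f i) (Bijection.to f j))
        × (S (Bijection.to f i) (Bijection.to f j) → R i j)

-- Colour the vertices 0,1,2,3,4,… of P_k by C, A, D, B and then alternately C, B, C, B, ….
-- A, B, C will be the triangle of F₁ and D its pendant vertex.  From vertex 3 on, B and C
-- alternate, so each of them alone dominates that part of the path; the first three
-- vertices are then dominated by A ∪ B, A ∪ C, B ∪ C and C ∪ D.  No single class and neither
-- A ∪ D nor B ∪ D dominates, since each misses the closed neighbourhood of a vertex:
-- N[4] is coloured B and C only, N[0] only C and A, and N[2] only D, A and B.
module Submission where

open import Defs
open import Data.Nat using (ℕ; suc; _+_; _<_; _≥_; s≤s; z≤n)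
open import Data.Nat.Properties using (<⇒≤)
open import Data.Fin using (Fin; zero; suc; toℕ; fromℕ<; #_)
open import Data.Fin.Properties using (toℕ<n; toℕ-fromℕ<)
open import Data.Product using (Σ; ∃; _×_; _,_)
open import Data.Sum using (_⊎_; inj₁; inj₂; swap)
open import Data.Empty using (⊥-elim)
open import Function using (_∘_)
open import Function.Construct.Identity using (⤖-id)
open import Relation.Nullary using (¬_)
open import Relation.Binary.PropositionalEquality
  using (_≡_; _≢_; refl; sym; trans; cong; subst)

module _ {n : ℕ} (G : Graph n) where

  coalition-sym : ∀ {S T} → Coalition G S T → Coalition G T S
  coalition-sym {S} {T} (S∩T , ¬domS , ¬domT , domS∪T) =
    (λ v Tv Sv → S∩T v Sv Tv) , ¬domT , ¬domS , domT∪S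
    where
    domT∪S : Dominating G (T ∪ S)
    domT∪S v ¬T∪S with domS∪T v (¬T∪S ∘ swap)
    ... | u , S∪Tu , adj = u , swap S∪Tu , adj

  ¬coalition-self : ∀ {m} (Ψ : Partition n m) i → ¬ Coalition G (Class Ψ i) (Class Ψ i)
  ¬coalition-self Ψ i (disjoint , _) with nonempty Ψ i
  ... | v , v∈i = disjoint v v∈i v∈i

  coalition-of-classes : ∀ {m} (Ψ : Partition n m) {i j} → i ≢ j →
    ¬ Dominating G (Class Ψ i) → ¬ Dominating G (Class Ψ j) →
    Dominating G (Class Ψ i ∪ Class Ψ j) → Coalition G (Class Ψ i) (Class Ψ j)
  coalition-of-classes Ψ i≢j ¬domi ¬domj domi∪j =
    (λ v v∈i v∈j → i≢j (trans (sym v∈i) v∈j)) , ¬domi , ¬domj , domi∪j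

-- Colourings are defined on all of ℕ, so ¬dominating-at may name the colour of a right
-- neighbour even past the end of the path.

module _ {k m : ℕ} (c : ℕ → Fin m) where

  Coloured : (Fin m → Set) → VSet k
  Coloured P v = P (c (toℕ v))

  colouringPartition : (∀ i → ∃ λ (v : Fin k) → c (toℕ v) ≡ i) → Partition k m
  colouringPartition onto = record { cls = c ∘ toℕ ; nonempty = onto }

  ¬dominating-at : ∀ (P : Fin m → Set) (v : Fin k) → ¬ P (c (toℕ v)) →
    (∀ p → suc p ≡ toℕ v → ¬ P (c p)) → ¬ P (c (suc (toℕ v))) →
    ¬ Dominating (PathGraph k) (Coloured P)
  ¬dominating-at P v ¬here ¬left ¬right dom with dom v ¬here
  ... | u , Pu , inj₁ u+1≡v = ¬left (toℕ u) u+1≡v Pu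
  ... | u , Pu , inj₂ v+1≡u = ¬right (subst (P ∘ c) (sym v+1≡u) Pu)

  data Covered (P : Fin m → Set) : ℕ → Set where
    here  : ∀ {p} → P (c p) → Covered P p
    left  : ∀ {p} → P (c p) → Covered P (suc p)
    right : ∀ {p} → suc p < k → P (c (suc p)) → Covered P p

  dominating-if-covered : ∀ (P : Fin m → Set) → (∀ (v : Fin k) → Covered P (toℕ v)) →
    Dominating (PathGraph k) (Coloured P)
  dominating-if-covered P covered v ¬Pv with toℕ v | toℕ<n v | covered v
  ... | _ | _ | here Pv = ⊥-elim (¬Pv Pv)
  ... | _ | p<k | left Pp =
    fromℕ< (<⇒≤ p<k) , subst (P ∘ c) (sym (toℕ-fromℕ< _)) Pp , inj₁ (cong suc (toℕ-fromℕ< _))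
  ... | _ | _ | right p+1<k Pp+1 =
    fromℕ< p+1<k , subst (P ∘ c) (sym (toℕ-fromℕ< _)) Pp+1 , inj₂ (sym (toℕ-fromℕ< _))

pattern A = zero
pattern B = suc zero
pattern C = suc (suc zero)
pattern D = suc (suc (suc zero))

colour : ℕ → Fin 4
colour 0 = C
colour 1 = A
colour 2 = D
colour 3 = B
colour 4 = C
colour (suc (suc (suc (suc (suc p))))) = colour (suc (suc (suc p)))

colour-alternates : ∀ j → (colour (3 + j) ≡ B × colour (4 + j) ≡ C)
                        ⊎ (colour (3 + j) ≡ C × colour (4 + j) ≡ B)
colour-alternates 0 = inj₁ (refl , refl)
colour-alternates 1 = inj₂ (refl , refl)
colour-alternates (suc (suc j)) = colour-alternates j

module _ {k : ℕ} {P : Fin 4 → Set} where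

  tail-covered-by-B : P B → ∀ j → Covered {k} colour P (4 + j)
  tail-covered-by-B PB j with colour-alternates j
  ... | inj₁ (3+j↦B , _) = left (subst P (sym 3+j↦B) PB)
  ... | inj₂ (_ , 4+j↦B) = here (subst P (sym 4+j↦B) PB)

  tail-covered-by-C : P C → ∀ j → Covered {k} colour P (4 + j)
  tail-covered-by-C PC j with colour-alternates j
  ... | inj₁ (_ , 4+j↦C) = here (subst P (sym 4+j↦C) PC)
  ... | inj₂ (3+j↦C , _) = left (subst P (sym 3+j↦C) PC)

Colours : Fin 4 → Fin 4 → Fin 4 → Set
Colours i j x = x ≡ i ⊎ x ≡ j

module F₁Colouring (n : ℕ) where

  K : ℕ
  K = 5 + n

  G : Graph K
  G = PathGraph K

  Ψ : Partition K 4
  Ψ = colouringPartition colour onto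
    where
    onto : ∀ i → ∃ λ (v : Fin K) → colour (toℕ v) ≡ i
    onto A = # 1 , refl
    onto B = # 3 , refl
    onto C = # 0 , refl
    onto D = # 2 , refl

  ¬dominating-without-B-C : ∀ P → ¬ P B → ¬ P C → ¬ Dominating G (Coloured colour P)
  ¬dominating-without-B-C P ¬B ¬C =
    ¬dominating-at colour P (# 4) ¬C (λ { _ refl → ¬B }) ¬B

  ¬dominating-without-A-C : ∀ P → ¬ P A → ¬ P C → ¬ Dominating G (Coloured colour P)
  ¬dominating-without-A-C P ¬A ¬C =
    ¬dominating-at colour P (# 0) ¬C (λ _ ()) ¬A

  ¬dominating-without-A-B-D : ∀ P → ¬ P A → ¬ P B → ¬ P D →
    ¬ Dominating G (Coloured colour P)
  ¬dominating-without-A-B-D P ¬A ¬B ¬D =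
    ¬dominating-at colour P (# 2) ¬D (λ { _ refl → ¬A }) ¬B

  ¬dominating-class : ∀ i → ¬ Dominating G (Class Ψ i)
  ¬dominating-class A = ¬dominating-without-B-C (_≡ A) (λ ()) (λ ())
  ¬dominating-class B = ¬dominating-without-A-C (_≡ B) (λ ()) (λ ())
  ¬dominating-class C = ¬dominating-without-A-B-D (_≡ C) (λ ()) (λ ()) (λ ())
  ¬dominating-class D = ¬dominating-without-B-C (_≡ D) (λ ()) (λ ())

  covered-A-B : ∀ p → Covered {K} colour (Colours A B) p
  covered-A-B 0 = right (s≤s (s≤s z≤n)) (inj₁ refl)
  covered-A-B 1 = here (inj₁ refl)
  covered-A-B 2 = left (inj₁ refl)
  covered-A-B 3 = here (inj₂ refl)
  covered-A-B (suc (suc (suc (suc j)))) = tail-covered-by-B (inj₂ refl) j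

  covered-A-C : ∀ p → Covered {K} colour (Colours A C) p
  covered-A-C 0 = here (inj₂ refl)
  covered-A-C 1 = here (inj₁ refl)
  covered-A-C 2 = left (inj₁ refl)
  covered-A-C 3 = right (s≤s (s≤s (s≤s (s≤s (s≤s z≤n))))) (inj₂ refl)
  covered-A-C (suc (suc (suc (suc j)))) = tail-covered-by-C (inj₂ refl) j

  covered-B-C : ∀ p → Covered {K} colour (Colours B C) p
  covered-B-C 0 = here (inj₂ refl)
  covered-B-C 1 = left (inj₂ refl)
  covered-B-C 2 = right (s≤s (s≤s (s≤s (s≤s z≤n)))) (inj₁ refl)
  covered-B-C 3 = here (inj₁ refl)
  covered-B-C (suc (suc (suc (suc j)))) = tail-covered-by-C (inj₂ refl) j

  covered-C-D : ∀ p → Covered {K} colour (Colours C D) p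
  covered-C-D 0 = here (inj₁ refl)
  covered-C-D 1 = left (inj₁ refl)
  covered-C-D 2 = here (inj₂ refl)
  covered-C-D 3 = left (inj₂ refl)
  covered-C-D (suc (suc (suc (suc j)))) = tail-covered-by-C (inj₁ refl) j

  coalition-of-cover : ∀ {i j} → i ≢ j → (∀ p → Covered {K} colour (Colours i j) p) →
    CGAdj G Ψ i j
  coalition-of-cover {i} {j} i≢j covered =
    coalition-of-classes G Ψ i≢j (¬dominating-class i) (¬dominating-class j)
      (dominating-if-covered colour (Colours i j) (covered ∘ toℕ))

  coalition : ∀ {i j} → F1Adj i j → CGAdj G Ψ i j
  coalition e01 = coalition-of-cover (λ ()) covered-A-B
  coalition e02 = coalition-of-cover (λ ()) covered-A-C
  coalition e12 = coalition-of-cover (λ ()) covered-B-C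
  coalition e23 = coalition-of-cover (λ ()) covered-C-D
  coalition e10 = coalition-sym G (coalition e01)
  coalition e20 = coalition-sym G (coalition e02)
  coalition e21 = coalition-sym G (coalition e12)
  coalition e32 = coalition-sym G (coalition e23)

  ¬coalition-A-D : ¬ CGAdj G Ψ A D
  ¬coalition-A-D (_ , _ , _ , dom) =
    ¬dominating-without-B-C (Colours A D)
      (λ { (inj₁ ()) ; (inj₂ ()) }) (λ { (inj₁ ()) ; (inj₂ ()) }) dom

  ¬coalition-B-D : ¬ CGAdj G Ψ B D
  ¬coalition-B-D (_ , _ , _ , dom) =
    ¬dominating-without-A-C (Colours B D)
      (λ { (inj₁ ()) ; (inj₂ ()) }) (λ { (inj₁ ()) ; (inj₂ ()) }) dom

  F1Adj-of-coalition : ∀ i j → CGAdj G Ψ i j → F1Adj i j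
  F1Adj-of-coalition A B _ = e01
  F1Adj-of-coalition A C _ = e02
  F1Adj-of-coalition B C _ = e12
  F1Adj-of-coalition C D _ = e23
  F1Adj-of-coalition B A _ = e10
  F1Adj-of-coalition C A _ = e20
  F1Adj-of-coalition C B _ = e21
  F1Adj-of-coalition D C _ = e32
  F1Adj-of-coalition A D c = ⊥-elim (¬coalition-A-D c)
  F1Adj-of-coalition D A c = ⊥-elim (¬coalition-A-D (coalition-sym G c))
  F1Adj-of-coalition B D c = ⊥-elim (¬coalition-B-D c)
  F1Adj-of-coalition D B c = ⊥-elim (¬coalition-B-D (coalition-sym G c))
  F1Adj-of-coalition A A c = ⊥-elim (¬coalition-self G Ψ A c)
  F1Adj-of-coalition B B c = ⊥-elim (¬coalition-self G Ψ B c)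
  F1Adj-of-coalition C C c = ⊥-elim (¬coalition-self G Ψ C c)
  F1Adj-of-coalition D D c = ⊥-elim (¬coalition-self G Ψ D c)

  isCoalitionPartition : IsCoalitionPartition G Ψ
  isCoalitionPartition A = inj₂ (¬dominating-class A , B , coalition e01)
  isCoalitionPartition B = inj₂ (¬dominating-class B , A , coalition e10)
  isCoalitionPartition C = inj₂ (¬dominating-class C , A , coalition e20)
  isCoalitionPartition D = inj₂ (¬dominating-class D , C , coalition e32)

proposition6 : ∀ (k : ℕ) → k ≥ 5 →
    ∃ λ (m : ℕ) → Σ (Partition k m) λ Ψ →
    IsCoalitionPartition (PathGraph k) Ψ × Iso (CGAdj (PathGraph k) Ψ) F1Adj
proposition6 _ (s≤s (s≤s (s≤s (s≤s (s≤s {n = n} z≤n))))) =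
  4 , Ψ , isCoalitionPartition , ⤖-id (Fin 4) , λ i j → F1Adj-of-coalition i j , coalition
  where open F₁Colouring n
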